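{- Let $k\geq 4$, $t\geq k+1$, and let $G$ be a spanning subgraph of $K_{t,t}$ with bipartition $(X,Y)$ that contains a cycle $C$ of length $2k$. Let $x\in X$ and $y\in Y$ be vertices not on $C$. Suppose that either $xy\notin E(G)$ and each of $x,y$ is adjacent to at least $k-1$ vertices of $C$, or $xy\in E(G)$ and each of $x,y$ is adjacent to at least $\lceil k/2\rceil+1$ vertices of $C$. Then $G$ contains a cycle of length $2k+2$.
   Context: $K_{t,t}$ is the complete bipartite graph with both parts of size $t$. -}

module Defs where

open import Data.Nat using (ℕ; zero; suc)
open import Data.Nat.DivMod using (_mod_)
open import Data.Fin using (Fin; toℕ)
open import Data.Product using (Σ; _×_)
open import Relation.Binary.PropositionalEquality using (_≡_)
open import Function.Definitions using (Injective)

next : ∀ {n} → Fin n → Fin n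
next {suc n} i = suc (toℕ i) mod suc n

-- A bipartite graph with parts X = Fin t and Y = Fin t (a spanning subgraph
-- of K_{t,t}) is given by its adjacency relation  Adj : X → Y → Set.
-- A cycle of length 2k in it: distinct x_0..x_{k-1} ∈ X, distinct
-- y_0..y_{k-1} ∈ Y, with edges x_i y_i and y_i x_{i+1 mod k}, i.e. the
-- closed walk x_0 y_0 x_1 y_1 ... x_{k-1} y_{k-1} x_0.
record Cycle (t : ℕ) (Adj : Fin t → Fin t → Set) (k : ℕ) : Set where
  field
    xs    : Fin k → Fin t
    ys    : Fin k → Fin t
    xs-inj : Injective _≡_ _≡_ xs
    ys-inj : Injective _≡_ _≡_ ys
    edge₁ : ∀ i → Adj (xs i) (ys i)
    edge₂ : ∀ i → Adj (xs (next i)) (ys i)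

AtLeast : ∀ {k} → ℕ → (Fin k → Set) → Set
AtLeast {k} m P = Σ (Fin m → Fin k) λ f → Injective _≡_ _≡_ f × (∀ j → P (f j))

-- If xy is an edge, ⌈k/2⌉ + 1 neighbours of x and of y on C force, by pigeonhole,
-- an index i with x ∼ yᵢ and xᵢ ∼ y, and replacing the edge xᵢyᵢ by the path
-- xᵢ y x yᵢ lengthens C by two. Otherwise x misses at most one yⱼ and y at most one
-- xⱼ. Rotate C so that x's possible non-neighbour is y_{k-1}; since k ≥ 4, x ∼ y₀, y₁, y₂.
-- Then y ∼ x₀, x₁ and x₀ y x₁ y₀ x y₁ x₂ … is a cycle, or y ∼ x₁, x₂ and
-- x₀ y₀ x y₁ x₁ y x₂ … is one, or y ∼ x₂, x₃ and the same detour works one step later.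
{-# OPTIONS --safe #-}
module Submission where

open import Defs
open import Data.Nat using (ℕ; zero; suc; _≟_; _+_; _∸_; _≤_; _<_; z≤n; s≤s; z<s; pred; ⌈_/2⌉; ⌊_/2⌋)
open import Data.Nat.Properties using (⌊n/2⌋+⌈n/2⌉≡n; ⌊n/2⌋≤⌈n/2⌉; +-monoˡ-≤; +-mono-<; m<m+n; module ≤-Reasoning; +-identityʳ; +-suc; suc-injective; pred-mono-≤; m≤n⇒m<n∨m≡n; ≤-refl)
open import Data.Nat.DivMod using (_%_; _mod_; m%n<n; n%n≡0; m%n%n≡m%n; m≤n⇒m%n≡m; [m+n]%n≡m%n; %-distribˡ-+)
open import Data.Fin using (Fin; toℕ; zero; suc; fromℕ; punchOut; splitAt; join) renaming (_≟_ to _≟ᶠ_)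
open import Data.Fin.Patterns using (0F; 1F; 2F; 3F)
open import Data.Fin.Properties
  using (toℕ-fromℕ<; toℕ-injective; toℕ≤pred[n]; toℕ-fromℕ; punchOut-injective; pigeonhole;
         <⇒≢; <⇒notInjective; join-splitAt; all?; ¬∀⟶∃¬)
open import Data.Product using (_×_; _,_; ∃-syntax)
open import Data.Sum using (_⊎_; inj₁; inj₂; [_,_]′)
open import Data.Empty using (⊥-elim)
open import Relation.Nullary using (¬_; Dec; yes; no)
open import Relation.Unary using (Decidable)
open import Relation.Binary.PropositionalEquality
open import Function.Base using (_∘_)
open import Function.Definitions using (Injective)

next^ : ∀ {k} → ℕ → Fin k → Fin k
next^ zero    i = i
next^ (suc r) i = next^ r (next i)

module _ {m : ℕ} where

  toℕ-mod : ∀ i → toℕ (i mod suc m) ≡ i % suc m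
  toℕ-mod i = toℕ-fromℕ< (m%n<n i (suc m))

  mod-cong : ∀ {i j} → i % suc m ≡ j % suc m → i mod suc m ≡ j mod suc m
  mod-cong {i} {j} e = toℕ-injective (trans (toℕ-mod i) (trans e (sym (toℕ-mod j))))

  mod-injective : ∀ {i j} → i ≤ m → j ≤ m → i mod suc m ≡ j mod suc m → i ≡ j
  mod-injective {i} {j} i≤m j≤m e = begin
    i             ≡⟨ m≤n⇒m%n≡m i≤m ⟨
    i % suc m     ≡⟨ toℕ-mod i ⟨
    toℕ (i mod _) ≡⟨ cong toℕ e ⟩
    toℕ (j mod _) ≡⟨ toℕ-mod j ⟩
    j % suc m     ≡⟨ m≤n⇒m%n≡m j≤m ⟩
    j             ∎
    where open ≡-Reasoning

  mod-toℕ : (i : Fin (suc m)) → toℕ i mod suc m ≡ i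
  mod-toℕ i = toℕ-injective (trans (toℕ-mod (toℕ i)) (m≤n⇒m%n≡m (toℕ≤pred[n] i)))

  next-mod : ∀ i → next (i mod suc m) ≡ suc i mod suc m
  next-mod i = mod-cong {suc (toℕ (i mod suc m))} {suc i} (begin
    suc (toℕ (i mod n)) % n   ≡⟨ cong (λ v → suc v % n) (toℕ-mod i) ⟩
    (1 + i % n) % n           ≡⟨ %-distribˡ-+ 1 (i % n) n ⟩
    (1 % n + i % n % n) % n   ≡⟨ cong (λ v → (1 % n + v) % n) (m%n%n≡m%n i n) ⟩
    (1 % n + i % n) % n       ≡⟨ %-distribˡ-+ 1 i n ⟨
    suc i % n                 ∎)
    where
    n = suc m
    open ≡-Reasoning

  next-fromℕ : next (fromℕ m) ≡ zero
  next-fromℕ = mod-cong {suc (toℕ (fromℕ m))} {0} (trans (cong (λ v → suc v % suc m) (toℕ-fromℕ m)) (n%n≡0 (suc m)))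



  next^-mod : ∀ r i → next^ r (i mod suc m) ≡ (i + r) mod suc m
  next^-mod zero    i = cong (_mod suc m) (sym (+-identityʳ i))
  next^-mod (suc r) i = begin
    next^ r (next (i mod suc m)) ≡⟨ cong (next^ r) (next-mod i) ⟩
    next^ r (suc i mod suc m)    ≡⟨ next^-mod r (suc i) ⟩
    (suc i + r) mod suc m        ≡⟨ cong (_mod suc m) (+-suc i r) ⟨
    (i + suc r) mod suc m        ∎
    where open ≡-Reasoning

  next^-next : ∀ r (i : Fin (suc m)) → next^ r (next i) ≡ next (next^ r i)
  next^-next zero    i = refl
  next^-next (suc r) i = next^-next r (next i)

  next^-zero : (i : Fin (suc m)) → next^ (toℕ i) zero ≡ i
  next^-zero i = trans (next^-mod (toℕ i) 0) (mod-toℕ i)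

  next^-period : (i : Fin (suc m)) → next^ (suc m) i ≡ i
  next^-period i = begin
    next^ (suc m) i                    ≡⟨ cong (next^ (suc m)) (mod-toℕ i) ⟨
    next^ (suc m) (toℕ i mod suc m)    ≡⟨ next^-mod (suc m) (toℕ i) ⟩
    (toℕ i + suc m) mod suc m          ≡⟨ mod-cong {i = toℕ i + suc m} {j = toℕ i} ([m+n]%n≡m%n (toℕ i) (suc m)) ⟩
    toℕ i mod suc m                    ≡⟨ mod-toℕ i ⟩
    i                                  ∎
    where open ≡-Reasoning

  next-injective : Injective _≡_ _≡_ (next {suc m})
  next-injective {i} {j} e =
    trans (sym (next^-period i)) (trans (cong (next^ m) e) (next^-period j))

  next^-injective : ∀ r → Injective _≡_ _≡_ (next^ {suc m} r)
  next^-injective zero    e = e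
  next^-injective (suc r) e = next-injective (next^-injective r e)

InjectiveUpTo : {A : Set} → ℕ → (ℕ → A) → Set
InjectiveUpTo m f = ∀ {i j} → i ≤ m → j ≤ m → f i ≡ f j → i ≡ j

insertAt : {A : Set} → ℕ → (ℕ → A) → A → ℕ → A
insertAt zero    f a zero    = a
insertAt zero    f a (suc i) = f i
insertAt (suc p) f a zero    = f zero
insertAt (suc p) f a (suc i) = insertAt p (λ i → f (suc i)) a i

-- the position in f of the entry at position i ≢ p of insertAt p f a
skip : ℕ → ℕ → ℕ
skip zero    i       = pred i
skip (suc p) zero    = zero
skip (suc p) (suc i) = suc (skip p i)

insertAt-at : ∀ {A : Set} p {f : ℕ → A} {a} → insertAt p f a p ≡ a
insertAt-at zero    = refl
insertAt-at (suc p) = insertAt-at p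

insertAt-skip : ∀ {A : Set} p {f : ℕ → A} {a i} → i ≢ p → insertAt p f a i ≡ f (skip p i)
insertAt-skip zero    {i = zero}  i≢p = ⊥-elim (i≢p refl)
insertAt-skip zero    {i = suc i} _   = refl
insertAt-skip (suc p) {i = zero}  _   = refl
insertAt-skip (suc p) {i = suc i} i≢p = insertAt-skip p (i≢p ∘ cong suc)

skip-injective : ∀ p {i j} → i ≢ p → j ≢ p → skip p i ≡ skip p j → i ≡ j
skip-injective zero    {zero}          i≢p _   _ = ⊥-elim (i≢p refl)
skip-injective zero    {suc i} {zero}  _   j≢p _ = ⊥-elim (j≢p refl)
skip-injective zero    {suc i} {suc j} _   _   e = cong suc e
skip-injective (suc p) {zero}  {zero}  _   _   _ = refl
skip-injective (suc p) {suc i} {suc j} i≢p j≢p e =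
  cong suc (skip-injective p (i≢p ∘ cong suc) (j≢p ∘ cong suc) (suc-injective e))

skip-≤ : ∀ p {m i} → p ≤ suc m → i ≤ suc m → i ≢ p → skip p i ≤ m
skip-≤ zero    _ i≤1+m _ = pred-mono-≤ i≤1+m
skip-≤ (suc p) {i = zero} _ _ _ = z≤n
skip-≤ (suc p) {zero}  {suc zero} (s≤s z≤n)   (s≤s z≤n)   i≢p = ⊥-elim (i≢p refl)
skip-≤ (suc p) {suc m} {suc i}    (s≤s p≤1+m) (s≤s i≤1+m) i≢p = s≤s (skip-≤ p p≤1+m i≤1+m (i≢p ∘ cong suc))

insertAt-injective : ∀ {A : Set} {m} p {f : ℕ → A} {a} → p ≤ suc m
  → InjectiveUpTo m f → (∀ i → f i ≢ a) → InjectiveUpTo (suc m) (insertAt p f a)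
insertAt-injective p {f} {a} p≤1+m f-inj f≢a {i} {j} i≤1+m j≤1+m e with i ≟ p | j ≟ p
... | yes refl | yes refl = refl
... | yes refl | no  j≢p  = ⊥-elim (f≢a _ (trans (sym (insertAt-skip p j≢p)) (trans (sym e) (insertAt-at p))))
... | no  i≢p  | yes refl = ⊥-elim (f≢a _ (trans (sym (insertAt-skip p i≢p)) (trans e (insertAt-at p))))
... | no  i≢p  | no  j≢p  = skip-injective p i≢p j≢p
  (f-inj (skip-≤ p p≤1+m i≤1+m i≢p) (skip-≤ p p≤1+m j≤1+m j≢p)
    (trans (sym (insertAt-skip p i≢p)) (trans e (insertAt-skip p j≢p))))

module _ {t : ℕ} {Adj : Fin t → Fin t → Set} where

  rotate : ∀ {m} → ℕ → Cycle t Adj (suc m) → Cycle t Adj (suc m)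
  rotate r C = record
    { xs     = λ i → xs (next^ r i)
    ; ys     = λ i → ys (next^ r i)
    ; xs-inj = λ e → next^-injective r (xs-inj e)
    ; ys-inj = λ e → next^-injective r (ys-inj e)
    ; edge₁  = λ i → edge₁ (next^ r i)
    ; edge₂  = λ i → subst (λ j → Adj (xs j) (ys (next^ r i))) (sym (next^-next r i)) (edge₂ (next^ r i))
    }
    where open Cycle C

  -- Cycles are taken apart and rebuilt as ℕ-indexed sequences, on which the index
  -- shifts caused by inserting x and y compute, unlike `next` on Fin.
  cycle-from-sequences : ∀ m (X Y : ℕ → Fin t) → InjectiveUpTo m X → InjectiveUpTo m Y
    → (∀ i → i ≤ m → Adj (X i) (Y i)) → (∀ i → i < m → Adj (X (suc i)) (Y i)) → Adj (X 0) (Y m)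
    → Cycle t Adj (suc m)
  cycle-from-sequences m X Y X-inj Y-inj X∼Y X₊₁∼Y closing = record
    { xs     = λ i → X (toℕ i)
    ; ys     = λ i → Y (toℕ i)
    ; xs-inj = λ {i} {j} e → toℕ-injective (X-inj (toℕ≤pred[n] i) (toℕ≤pred[n] j) e)
    ; ys-inj = λ {i} {j} e → toℕ-injective (Y-inj (toℕ≤pred[n] i) (toℕ≤pred[n] j) e)
    ; edge₁  = λ i → X∼Y (toℕ i) (toℕ≤pred[n] i)
    ; edge₂  = edge₂
    }
    where
    edge₂ : ∀ i → Adj (X (toℕ (next i))) (Y (toℕ i))
    edge₂ i with m≤n⇒m<n∨m≡n (toℕ≤pred[n] i)
    ... | inj₁ i<m = subst (λ j → Adj (X j) (Y (toℕ i)))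
                       (sym (trans (toℕ-mod (suc (toℕ i))) (m≤n⇒m%n≡m i<m))) (X₊₁∼Y (toℕ i) i<m)
    ... | inj₂ i≡m = subst₂ (λ j k → Adj (X j) (Y k)) (sym next-i≡0) (sym i≡m) closing
      where
      next-i≡0 : toℕ (next i) ≡ 0
      next-i≡0 = trans (toℕ-mod (suc (toℕ i))) (trans (cong (λ v → suc v % suc m) i≡m) (n%n≡0 (suc m)))

  module Unrolled {m} (C : Cycle t Adj (suc m)) where
    open Cycle C

    X Y : ℕ → Fin t
    X i = xs (i mod suc m)
    Y i = ys (i mod suc m)

    X-injective : InjectiveUpTo m X
    X-injective i≤m j≤m e = mod-injective i≤m j≤m (xs-inj e)

    Y-injective : InjectiveUpTo m Y
    Y-injective i≤m j≤m e = mod-injective i≤m j≤m (ys-inj e)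

    X∼Y : ∀ i → Adj (X i) (Y i)
    X∼Y i = edge₁ (i mod suc m)

    X₊₁∼Y : ∀ i → Adj (X (suc i)) (Y i)
    X₊₁∼Y i = subst (λ j → Adj (xs j) (Y i)) (next-mod i) (edge₂ (i mod suc m))

    X₀∼Yₘ : Adj (X 0) (Y m)
    X₀∼Yₘ = subst (λ j → Adj (xs j) (Y m)) (mod-cong {i = suc m} {j = 0} (n%n≡0 (suc m))) (X₊₁∼Y m)

  module _ {m} (C : Cycle t Adj (3 + m)) {x y : Fin t}
           (x∉C : ∀ i → Cycle.xs C i ≢ x) (y∉C : ∀ i → Cycle.ys C i ≢ y) where
    open Unrolled C

    private
      x∉X : ∀ i → X i ≢ x
      x∉X i = x∉C (i mod (3 + m))

      y∉Y : ∀ i → Y i ≢ y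
      y∉Y i = y∉C (i mod (3 + m))

      cycle-inserting : ∀ p q → p ≤ 3 + m → q ≤ 3 + m
        → (∀ i → i ≤ 3 + m → Adj (insertAt p X x i) (insertAt q Y y i))
        → (∀ i → i < 3 + m → Adj (insertAt p X x (suc i)) (insertAt q Y y i))
        → Adj (insertAt p X x 0) (insertAt q Y y (3 + m))
        → Cycle t Adj (4 + m)
      cycle-inserting p q p≤ q≤ = cycle-from-sequences (3 + m) (insertAt p X x) (insertAt q Y y)
        (insertAt-injective p p≤ X-injective x∉X) (insertAt-injective q q≤ Y-injective y∉Y)

    -- x₀ y x y₀ x₁ y₁ …
    insert-via-xy : Adj x y → Adj x (Y 0) → Adj (X 0) y → Cycle t Adj (4 + m)
    insert-via-xy x∼y x∼Y₀ X₀∼y = cycle-inserting 1 0 (s≤s z≤n) z≤n X′∼Y′ X′₊₁∼Y′ X₀∼Yₘ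
      where
      X′∼Y′ : ∀ i → i ≤ 3 + m → Adj (insertAt 1 X x i) (insertAt 0 Y y i)
      X′∼Y′ zero          _ = X₀∼y
      X′∼Y′ (suc zero)    _ = x∼Y₀
      X′∼Y′ (suc (suc i)) _ = X∼Y (suc i)
      X′₊₁∼Y′ : ∀ i → i < 3 + m → Adj (insertAt 1 X x (suc i)) (insertAt 0 Y y i)
      X′₊₁∼Y′ zero    _ = x∼y
      X′₊₁∼Y′ (suc i) _ = X₊₁∼Y i

    -- x₀ y x₁ y₀ x y₁ x₂ y₂ …
    insert-via-X₀X₁ : Adj x (Y 0) → Adj x (Y 1) → Adj (X 0) y → Adj (X 1) y → Cycle t Adj (4 + m)
    insert-via-X₀X₁ x∼Y₀ x∼Y₁ X₀∼y X₁∼y = cycle-inserting 2 0 (s≤s (s≤s z≤n)) z≤n X′∼Y′ X′₊₁∼Y′ X₀∼Yₘ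
      where
      X′∼Y′ : ∀ i → i ≤ 3 + m → Adj (insertAt 2 X x i) (insertAt 0 Y y i)
      X′∼Y′ zero                _ = X₀∼y
      X′∼Y′ (suc zero)          _ = X₊₁∼Y 0
      X′∼Y′ (suc (suc zero))    _ = x∼Y₁
      X′∼Y′ (suc (suc (suc i))) _ = X∼Y (suc (suc i))
      X′₊₁∼Y′ : ∀ i → i < 3 + m → Adj (insertAt 2 X x (suc i)) (insertAt 0 Y y i)
      X′₊₁∼Y′ zero             _ = X₁∼y
      X′₊₁∼Y′ (suc zero)       _ = x∼Y₀
      X′₊₁∼Y′ (suc (suc i))    _ = X₊₁∼Y (suc i)

    -- x₀ y₀ x y₁ x₁ y x₂ y₂ …
    insert-via-X₁X₂ : Adj x (Y 0) → Adj x (Y 1) → Adj (X 1) y → Adj (X 2) y → Cycle t Adj (4 + m)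
    insert-via-X₁X₂ x∼Y₀ x∼Y₁ X₁∼y X₂∼y = cycle-inserting 1 2 (s≤s z≤n) (s≤s (s≤s z≤n)) X′∼Y′ X′₊₁∼Y′ X₀∼Yₘ
      where
      X′∼Y′ : ∀ i → i ≤ 3 + m → Adj (insertAt 1 X x i) (insertAt 2 Y y i)
      X′∼Y′ zero                _ = X∼Y 0
      X′∼Y′ (suc zero)          _ = x∼Y₁
      X′∼Y′ (suc (suc zero))    _ = X₁∼y
      X′∼Y′ (suc (suc (suc i))) _ = X∼Y (suc (suc i))
      X′₊₁∼Y′ : ∀ i → i < 3 + m → Adj (insertAt 1 X x (suc i)) (insertAt 2 Y y i)
      X′₊₁∼Y′ zero                _ = x∼Y₀
      X′₊₁∼Y′ (suc zero)          _ = X∼Y 1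
      X′₊₁∼Y′ (suc (suc zero))    _ = X₂∼y
      X′₊₁∼Y′ (suc (suc (suc i))) _ = X₊₁∼Y (suc (suc i))

AtLeast-intersect : ∀ {k c} {P Q : Fin k → Set} → k < c + c → AtLeast c P → AtLeast c Q → ∃[ i ] P i × Q i
AtLeast-intersect {k} {c} {P} {Q} k<2c (f , f-inj , fP) (g , g-inj , gQ)
  with l , l′ , l<l′ , e ← pigeonhole k<2c (λ l → [ f , g ]′ (splitAt c l)) =
  common (splitAt c l) (splitAt c l′) splitAt-distinct e
  where
  splitAt-distinct : splitAt c l ≢ splitAt c l′
  splitAt-distinct e = <⇒≢ l<l′ (trans (sym (join-splitAt c c l)) (trans (cong (join c c) e) (join-splitAt c c l′)))
  common : (u v : Fin c ⊎ Fin c) → u ≢ v → [ f , g ]′ u ≡ [ f , g ]′ v → ∃[ i ] P i × Q i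
  common (inj₁ a) (inj₁ b) u≢v e = ⊥-elim (u≢v (cong inj₁ (f-inj e)))
  common (inj₁ a) (inj₂ b) _   e = f a , fP a , subst Q (sym e) (gQ b)
  common (inj₂ a) (inj₁ b) _   e = f b , fP b , subst Q e (gQ a)
  common (inj₂ a) (inj₂ b) u≢v e = ⊥-elim (u≢v (cong inj₂ (g-inj e)))

¬AtLeast-two-outside : ∀ {n} {P : Fin (suc (suc n)) → Set} {i j} → i ≢ j → ¬ P i → ¬ P j → ¬ AtLeast (suc n) P
¬AtLeast-two-outside {n} {P} {i} {j} i≢j ¬Pi ¬Pj (f , f-inj , fP) = <⇒notInjective ≤-refl h-injective
  where
  i≢f : ∀ l → i ≢ f l
  i≢f l e = ¬Pi (subst P (sym e) (fP l))
  j′≢f : ∀ l → punchOut i≢j ≢ punchOut (i≢f l)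
  j′≢f l e = ¬Pj (subst P (sym (punchOut-injective i≢j (i≢f l) e)) (fP l))
  h : Fin (suc n) → Fin n
  h l = punchOut (j′≢f l)
  h-injective : Injective _≡_ _≡_ h
  h-injective {l} {l′} e = f-inj (punchOut-injective (i≢f l) (i≢f l′) (punchOut-injective (j′≢f l) (j′≢f l′) e))

all-but-one : ∀ {n} {P : Fin (suc (suc n)) → Set} → Decidable P → AtLeast (suc n) P → ∃[ a ] (∀ j → j ≢ a → P j)
all-but-one {n} {P} P? N with all? P?
... | yes ∀P = zero , λ j _ → ∀P j
... | no ¬∀P with a , ¬Pa ← ¬∀⟶∃¬ _ P P? ¬∀P = a , P-off-a
  where
  P-off-a : ∀ j → j ≢ a → P j
  P-off-a j j≢a with P? j
  ... | yes Pj  = Pj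
  ... | no  ¬Pj = ⊥-elim (¬AtLeast-two-outside (j≢a ∘ sym) ¬Pa ¬Pj N)

n<2[⌈n/2⌉+1] : ∀ n → n < (⌈ n /2⌉ + 1) + (⌈ n /2⌉ + 1)
n<2[⌈n/2⌉+1] n = begin-strict
  n                              ≡⟨ ⌊n/2⌋+⌈n/2⌉≡n n ⟨
  ⌊ n /2⌋ + ⌈ n /2⌉              ≤⟨ +-monoˡ-≤ ⌈ n /2⌉ (⌊n/2⌋≤⌈n/2⌉ n) ⟩
  ⌈ n /2⌉ + ⌈ n /2⌉              <⟨ +-mono-< (m<m+n ⌈ n /2⌉ z<s) (m<m+n ⌈ n /2⌉ z<s) ⟩
  (⌈ n /2⌉ + 1) + (⌈ n /2⌉ + 1)  ∎
  where open ≤-Reasoning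

module _ {t : ℕ} {Adj : Fin t → Fin t → Set} {m} (C : Cycle t Adj (3 + m)) {x y : Fin t}
         (x∉C : ∀ i → Cycle.xs C i ≢ x) (y∉C : ∀ i → Cycle.ys C i ≢ y) where
  open Cycle C

  extend-adjacent : ∀ {c} → 3 + m < c + c → Adj x y
    → AtLeast c (λ i → Adj x (ys i)) → AtLeast c (λ i → Adj (xs i) y) → Cycle t Adj (4 + m)
  extend-adjacent 3+m<2c x∼y Nx Ny with i , x∼yᵢ , xᵢ∼y ← AtLeast-intersect 3+m<2c Nx Ny =
    insert-via-xy (rotate r C) (x∉C ∘ next^ r) (y∉C ∘ next^ r) x∼y
      (subst (λ j → Adj x (ys j)) (sym (next^-zero i)) x∼yᵢ)
      (subst (λ j → Adj (xs j) y) (sym (next^-zero i)) xᵢ∼y)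
    where r = toℕ i

module _ {t : ℕ} {Adj : Fin t → Fin t → Set} {n} (C : Cycle t Adj (4 + n)) {x y : Fin t}
         (x∉C : ∀ i → Cycle.xs C i ≢ x) (y∉C : ∀ i → Cycle.ys C i ≢ y) where
  open Cycle C

  extend-all-but-one : (a b : Fin (4 + n)) → (∀ j → j ≢ a → Adj x (ys j)) → (∀ j → j ≢ b → Adj (xs j) y)
    → Cycle t Adj (5 + n)
  extend-all-but-one a b x∼ ∼y = extend (b ≟ᶠ σ 2F) (b ≟ᶠ σ 1F)
    where
    -- rotating by r makes a the last index
    r = suc (toℕ a)
    σ = next^ r
    σ-last : σ (fromℕ _) ≡ a
    σ-last = trans (cong (next^ (toℕ a)) next-fromℕ) (next^-zero a)
    x∼σ : ∀ j → j ≢ fromℕ _ → Adj x (ys (σ j))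
    x∼σ j j≢last = x∼ (σ j) (λ e → j≢last (next^-injective r (trans e (sym σ-last))))
    σ∼y-off : ∀ i j → b ≡ σ i → j ≢ i → Adj (xs (σ j)) y
    σ∼y-off i j b≡σᵢ j≢i = ∼y _ (λ e → j≢i (next^-injective r (trans e b≡σᵢ)))
    extend : Dec (b ≡ σ 2F) → Dec (b ≡ σ 1F) → Cycle t Adj (5 + n)
    extend (yes b≡σ₂) _ = insert-via-X₀X₁ (rotate r C) (x∉C ∘ σ) (y∉C ∘ σ)
      (x∼σ 0F (λ ())) (x∼σ 1F (λ ())) (σ∼y-off 2F 0F b≡σ₂ (λ ())) (σ∼y-off 2F 1F b≡σ₂ (λ ()))
    extend (no _) (yes b≡σ₁) = insert-via-X₁X₂ (rotate (suc r) C) (x∉C ∘ σ ∘ next) (y∉C ∘ σ ∘ next)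
      (x∼σ 1F (λ ())) (x∼σ 2F (λ ())) (σ∼y-off 1F 2F b≡σ₁ (λ ())) (σ∼y-off 1F 3F b≡σ₁ (λ ()))
    extend (no b≢σ₂) (no b≢σ₁) = insert-via-X₁X₂ (rotate r C) (x∉C ∘ σ) (y∉C ∘ σ)
      (x∼σ 0F (λ ())) (x∼σ 1F (λ ())) (∼y (σ 1F) (b≢σ₁ ∘ sym)) (∼y (σ 2F) (b≢σ₂ ∘ sym))

  extend-nonadjacent : (∀ u v → Dec (Adj u v))
    → AtLeast (3 + n) (λ i → Adj x (ys i)) → AtLeast (3 + n) (λ i → Adj (xs i) y) → Cycle t Adj (5 + n)
  extend-nonadjacent Adj? Nx Ny
    with a , x∼ ← all-but-one (λ i → Adj? x (ys i)) Nx
       | b , ∼y ← all-but-one (λ i → Adj? (xs i) y) Ny = extend-all-but-one a b x∼ ∼y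

lemma2 : (k t : ℕ) → 4 ≤ k → suc k ≤ t
    → (Adj : Fin t → Fin t → Set) → (∀ a b → Dec (Adj a b))
    → (C : Cycle t Adj k)
    → (x y : Fin t)
    → (∀ i → Cycle.xs C i ≢ x) → (∀ i → Cycle.ys C i ≢ y)
    → ((¬ Adj x y)
         × AtLeast (k ∸ 1) (λ i → Adj x (Cycle.ys C i))
         × AtLeast (k ∸ 1) (λ i → Adj (Cycle.xs C i) y))
      ⊎ (Adj x y
         × AtLeast (⌈ k /2⌉ + 1) (λ i → Adj x (Cycle.ys C i))
         × AtLeast (⌈ k /2⌉ + 1) (λ i → Adj (Cycle.xs C i) y))
    → Cycle t Adj (suc k)
lemma2 k _ (s≤s (s≤s (s≤s (s≤s _)))) _ _ Adj? C _ _ x∉C y∉C (inj₁ (_ , Nx , Ny)) =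
  extend-nonadjacent C x∉C y∉C Adj? Nx Ny
lemma2 k _ (s≤s (s≤s (s≤s (s≤s _)))) _ _ _ C _ _ x∉C y∉C (inj₂ (x∼y , Nx , Ny)) =
  extend-adjacent C x∉C y∉C (n<2[⌈n/2⌉+1] k) x∼y Nx Ny
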